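{- Let $g(n)$ be the label of the parent of the vertex labelled $n+1$ in the labelled infinite tree $\mathcal G$ defined below, and let $f(n)=\#\{m\ge 1: g(m)=n\}$ for $n\ge 1$ (the frequency sequence of $g$). Define finite words over the alphabet $\{1,2\}$ by $w_1=2$, $w_2=1$, $w_3=2$, and $w_n=w_{n-2}w_{n-1}$ (concatenation) for $n>3$. Then the infinite word $W=f(1)f(2)f(3)\cdots$ obtained by concatenating the values $f(n)$ factorizes as $$W=w_1\,w_2\,\prod_{n=3}^{\infty} w_n^2,$$ where the product denotes concatenation in increasing order of $n$ and $w_n^2=w_nw_n$.
   Context: The tree $\mathcal G$ is the infinite rooted plane tree (children of each vertex are ordered from left to right) defined recursively as follows: the root has a left child and a right child; the subtree rooted at the left child is a copy of $\mathcal G$; the right child has exactly one child, and the subtree rooted at that child is a copy of $\mathcal G$. Equivalently, vertices are of two types: a vertex of type A has exactly two children, the left of type A and the right of type B; a vertex of type B has exactly one child, of type A; the root is of type A. The vertices are labelled by the positive integers: the root gets label $1$, and then vertices are labelled consecutively in increasing order of height, and, within a fixed height, in increasing order from right to left. -}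

module Defs where

open import Data.Nat using (ℕ; zero; suc; _+_; _≤_)
open import Data.List using (List; []; _∷_; _++_; _∷ʳ_; map; concatMap; concat; length; upTo)
open import Data.Nat.ListAction using (sum)
open import Data.List.Membership.Propositional using (_∈_)
open import Data.List.Relation.Unary.Unique.Propositional using (Unique)
open import Data.Product using (Σ; _×_; _,_)
open import Function.Bundles using (_⇔_)
open import Relation.Binary.PropositionalEquality using (_≡_)

data Ty : Set where
  A B : Ty

-- A vertex is identified by its path from the root: the list of child
-- indices (0 = leftmost child), read from the root downwards.
Path : Set
Path = List ℕ

children : Path × Ty → List (Path × Ty)
children (p , A) = (p ∷ʳ 0 , A) ∷ (p ∷ʳ 1 , B) ∷ []
children (p , B) = (p ∷ʳ 0 , A) ∷ []

level : ℕ → List (Path × Ty)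
level zero    = ([] , A) ∷ []
level (suc h) = concatMap children (level h)

below : ℕ → ℕ
below h = sum (map (λ j → length (level j)) (upTo h))

-- Labels: increasing height, and within a height from right to left.
-- If level h = xs ++ v ∷ ys, then v has exactly length ys vertices to its right.
Labelled : Path → ℕ → Set
Labelled p n = Σ Ty λ t → Σ (List (Path × Ty)) λ xs → Σ (List (Path × Ty)) λ ys →
  (level (length p) ≡ xs ++ (p , t) ∷ ys) × (n ≡ below (length p) + length ys + 1)

-- IsG m k : g(m) = k, i.e. the parent of the vertex labelled m+1 is labelled k.
-- (The parent of the vertex with path p ∷ʳ i is the vertex with path p.)
IsG : ℕ → ℕ → Set
IsG m k = Σ Path λ p → Σ ℕ λ i → Labelled (p ∷ʳ i) (suc m) × Labelled p k

IsFreq : ℕ → ℕ → Set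
IsFreq n c = Σ (List ℕ) λ xs → Unique xs × (length xs ≡ c) ×
  ((m : ℕ) → (m ∈ xs) ⇔ ((1 ≤ m) × IsG m n))

-- The words w_n (index 0 is unused and set to the empty word).
w : ℕ → List ℕ
w 0 = []
w 1 = 2 ∷ []
w 2 = 1 ∷ []
w 3 = 2 ∷ []
w (suc (suc (suc (suc n)))) = w (suc (suc n)) ++ w (suc (suc (suc n)))

-- The finite prefix  w_1 w_2 ∏_{n=3}^{k+2} w_n^2  of the claimed factorization.
factorPrefix : ℕ → List ℕ
factorPrefix k = w 1 ++ w 2 ++ concat (map (λ j → w (3 + j) ++ w (3 + j)) (upTo k))

prefixW : (ℕ → ℕ) → ℕ → List ℕ
prefixW f L = map (λ i → f (suc i)) (upTo L)

module Submission where

-- The vertex labelled n has two children if it has type A and one if it has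
-- type B, and the vertices labelled m + 1 with g(m) = n are exactly these
-- children; hence f(n) is the arity of the vertex labelled n.  Labels run
-- through the levels one after another, each from right to left, so W is the
-- concatenation of the words R h of arities of level h read right to left.
-- A vertex of type A produces "1 2" (children B, A reversed) on the next
-- level and one of type B produces "2"; so R (h + 1) arises from R h by the
-- substitution 1 ↦ 2, 2 ↦ 1 2, which forces R (h + 2) = R h R (h + 1) and
-- R h = w (h + 3).  As wₙ wₙ wₙ₊₁ = wₙ wₙ₊₂, the word w₁ w₂ w₃² ⋯ w_{k+2}²
-- followed by w_{k+3} is R 0 R 1 ⋯ R (k + 1), a prefix of W.

open import Defs
open import Data.Nat using (ℕ; zero; suc; _+_; _≤_; _<_; z≤n; s≤s; _<?_)
open import Data.Nat.Properties
open import Data.Nat.ListAction using (sum)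
open import Data.Nat.ListAction.Properties using (sum-++)
open import Data.List using (List; []; _∷_; _++_; _∷ʳ_; map; concatMap; concat; length; upTo; reverse)
open import Data.List.Properties hiding (sum-++)
open import Data.List.Membership.Propositional using (_∈_)
open import Data.List.Membership.Propositional.Properties
  using (∈-++⁺ʳ; ∈-∃++; ∈-map⁺; ∈-map⁻; ∈-concat⁺′; ∈-concat⁻′)
open import Data.List.Membership.Propositional.Properties.WithK using (unique∧set⇒bag)
open import Data.List.Relation.Unary.Any using (here; there)
open import Data.List.Relation.Unary.All as All using (All; []; _∷_)
import Data.List.Relation.Unary.All.Properties as AllP
open import Data.List.Relation.Unary.AllPairs as AllPairs using (AllPairs; []; _∷_)
import Data.List.Relation.Unary.AllPairs.Properties as AllPairsP
open import Data.List.Relation.Binary.BagAndSetEquality using (∼bag⇒↭)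
open import Data.List.Relation.Binary.Permutation.Propositional.Properties using (↭-length)
open import Data.Product using (Σ; _×_; _,_; proj₁; proj₂; map₁)
open import Data.Sum using (_⊎_; inj₁; inj₂)
open import Data.Empty using (⊥-elim)
open import Function using (_∘_)
open import Function.Bundles using (mk⇔)
import Function.Properties.Equivalence as ⇔
open import Relation.Nullary using (yes; no)
open import Relation.Binary.PropositionalEquality
open import Relation.Binary.Definitions using (tri<; tri≈; tri>)

-- (1) The levels of the tree

Vertex : Set
Vertex = Path × Ty

arity : Ty → ℕ
arity A = 2
arity B = 1

ChildIndex : Ty → ℕ → Set
ChildIndex A i = i ≡ 0 ⊎ i ≡ 1
ChildIndex B i = i ≡ 0

∈-children : ∀ {u} (v : Vertex) → u ∈ children v →
  Σ ℕ λ i → proj₁ u ≡ proj₁ v ∷ʳ i × ChildIndex (proj₂ v) i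
∈-children (p , A) (here refl)         = 0 , refl , inj₁ refl
∈-children (p , A) (there (here refl)) = 1 , refl , inj₂ refl
∈-children (p , B) (here refl)         = 0 , refl , refl

siblings-differ : ∀ (p : Path) → p ∷ʳ 0 ≢ p ∷ʳ 1
siblings-differ p eq with ∷ʳ-injectiveʳ p p eq
... | ()

length-snoc : ∀ (p : Path) i → length (p ∷ʳ i) ≡ suc (length p)
length-snoc p i = trans (length-++ p) (+-comm (length p) 1)

∈-level-suc⁻ : ∀ h {u} → u ∈ level (suc h) → Σ Vertex λ v → v ∈ level h × u ∈ children v
∈-level-suc⁻ h u∈ with ∈-concat⁻′ (map children (level h)) u∈
... | _ , u∈cs , cs∈ with ∈-map⁻ children cs∈
... | v , v∈ , refl = v , v∈ , u∈cs

∈-level-suc⁺ : ∀ h {u v} → v ∈ level h → u ∈ children v → u ∈ level (suc h)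
∈-level-suc⁺ h v∈ u∈ = ∈-concat⁺′ u∈ (∈-map⁺ children v∈)

level-path-length : ∀ h {v} → v ∈ level h → length (proj₁ v) ≡ h
level-path-length zero    (here refl) = refl
level-path-length (suc h) u∈ with ∈-level-suc⁻ h u∈
... | v , v∈ , u∈ch with ∈-children v u∈ch
... | i , u≡ , _ = trans (cong length u≡)
  (trans (length-snoc (proj₁ v) i) (cong suc (level-path-length h v∈)))

split-level-path : ∀ h xs {p t} ys → level h ≡ xs ++ (p , t) ∷ ys → length p ≡ h
split-level-path h xs ys e = level-path-length h (subst (_ ∈_) (sym e) (∈-++⁺ʳ xs (here refl)))

IsVertex : Path → Ty → Set
IsVertex p t = (p , t) ∈ level (length p)

child-isVertex : ∀ {p t q t'} → IsVertex p t → (q , t') ∈ children (p , t) → IsVertex q t'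
child-isVertex {p} {t} {t' = t'} v c with ∈-children (p , t) c
... | i , refl , _ =
  subst (λ h → (p ∷ʳ i , t') ∈ level h) (sym (length-snoc p i)) (∈-level-suc⁺ (length p) v c)

parent-isVertex : ∀ {q i t'} → IsVertex (q ∷ʳ i) t' → Σ Ty λ t → IsVertex q t × ChildIndex t i
parent-isVertex {q} {i} {t'} u
  with ∈-level-suc⁻ (length q) (subst (λ h → (q ∷ʳ i , t') ∈ level h) (length-snoc q i) u)
... | (p , t) , v , c with ∈-children (p , t) c
... | j , e , ok with ∷ʳ-injective q p e
... | refl , refl = t , v , ok

level-inhabited : ∀ h → Σ Vertex (_∈ level h)
level-inhabited zero = ([] , A) , here refl
level-inhabited (suc h) with level-inhabited h
... | (p , A) , v = (p ∷ʳ 0 , A) , ∈-level-suc⁺ h v (here refl)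
... | (p , B) , v = (p ∷ʳ 0 , A) , ∈-level-suc⁺ h v (here refl)

level-nonempty : ∀ h → 1 ≤ length (level h)
level-nonempty h = nonempty (proj₂ (level-inhabited h))
  where
  nonempty : ∀ {v : Vertex} {vs} → v ∈ vs → 1 ≤ length vs
  nonempty (here _)  = s≤s z≤n
  nonempty (there _) = s≤s z≤n

Distinct : List Vertex → Set
Distinct = AllPairs (λ u v → proj₁ u ≢ proj₁ v)

children-distinct : ∀ v → Distinct (children v)
children-distinct (p , A) = (siblings-differ p ∷ []) ∷ [] ∷ []
children-distinct (p , B) = [] ∷ []

children-disjoint : ∀ {u v} → proj₁ u ≢ proj₁ v →
  All (λ x → All (λ y → proj₁ x ≢ proj₁ y) (children v)) (children u)
children-disjoint {u} {v} u≢v = All.tabulate λ x∈ → All.tabulate λ y∈ x≡y →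
  u≢v (∷ʳ-injectiveˡ _ _
    (trans (sym (proj₁ (proj₂ (∈-children u x∈)))) (trans x≡y (proj₁ (proj₂ (∈-children v y∈))))))

level-distinct : ∀ h → Distinct (level h)
level-distinct zero    = [] ∷ []
level-distinct (suc h) = AllPairsP.concat⁺
  (AllP.map⁺ (All.tabulate λ {v} _ → children-distinct v))
  (AllPairsP.map⁺ (AllPairs.map children-disjoint (level-distinct h)))

distinct-position : ∀ (xs xs' : List Vertex) {p t t' ys ys'} → Distinct (xs ++ (p , t) ∷ ys) →
  xs ++ (p , t) ∷ ys ≡ xs' ++ (p , t') ∷ ys' → t ≡ t' × ys ≡ ys'
distinct-position [] [] _ refl = refl , refl
distinct-position [] (_ ∷ xs') (p∉ys ∷ _) eq with ∷-injective eq
... | refl , ys≡ = ⊥-elim (All.lookup p∉ys (subst (_ ∈_) (sym ys≡) (∈-++⁺ʳ xs' (here refl))) refl)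
distinct-position (_ ∷ xs) [] (p∉ ∷ _) eq with ∷-injective eq
... | refl , _ = ⊥-elim (All.lookup p∉ (∈-++⁺ʳ xs (here refl)) refl)
distinct-position (_ ∷ xs) (_ ∷ xs') (_ ∷ d) eq = distinct-position xs xs' d (∷-injectiveʳ eq)

-- (2) Splittings of lists

++-split-prefix : ∀ {X : Set} (xs xs' : List X) {ys ys'} → xs ++ ys ≡ xs' ++ ys' →
  length xs ≡ length xs' → xs ≡ xs' × ys ≡ ys'
++-split-prefix []       []         eq _ = refl , eq
++-split-prefix (x ∷ xs) (_ ∷ xs') eq l with ∷-injective eq
... | refl , eq' = map₁ (cong (x ∷_)) (++-split-prefix xs xs' eq' (suc-injective l))

++-split-suffix : ∀ {X : Set} (xs xs' : List X) {ys ys'} → xs ++ ys ≡ xs' ++ ys' →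
  length ys ≡ length ys' → xs ≡ xs' × ys ≡ ys'
++-split-suffix xs xs' {ys} eq l = ++-split-prefix xs xs' eq (+-cancelʳ-≡ (length ys) _ _ lengths)
  where
  lengths : length xs + length ys ≡ length xs' + length ys
  lengths = trans (sym (length-++ xs))
    (trans (cong length eq) (trans (length-++ xs') (cong (length xs' +_) (sym l))))

suffix-shorter : ∀ {X : Set} {zs : List X} xs {v ys} → zs ≡ xs ++ v ∷ ys → length ys < length zs
suffix-shorter xs {ys = ys} refl =
  subst (length ys <_) (sym (length-++ xs)) (m≤n+m (suc (length ys)) (length xs))

split-from-right : ∀ {X : Set} (zs : List X) j → j < length zs →
  Σ (List X) λ xs → Σ X λ v → Σ (List X) λ ys → zs ≡ xs ++ v ∷ ys × length ys ≡ j
split-from-right (z ∷ zs) j (s≤s j≤) with m≤n⇒m<n∨m≡n j≤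
... | inj₂ refl = [] , z , zs , refl , refl
... | inj₁ j< with split-from-right zs j j<
... | xs , v , ys , e , l = z ∷ xs , v , ys , cong (z ∷_) e , l

-- (3) The number of vertices below a level

below-suc : ∀ h → below (suc h) ≡ below h + length (level h)
below-suc h = begin
    sum (map size (upTo (suc h)))        ≡⟨ cong (sum ∘ map size) (sym (upTo-∷ʳ h)) ⟩
    sum (map size (upTo h ∷ʳ h))         ≡⟨ cong sum (map-++ size (upTo h) (h ∷ [])) ⟩
    sum (map size (upTo h) ++ size h ∷ []) ≡⟨ sum-++ (map size (upTo h)) (size h ∷ []) ⟩
    below h + (size h + 0)               ≡⟨ cong (below h +_) (+-identityʳ (size h)) ⟩
    below h + size h                     ∎
  where
  open ≡-Reasoning
  size : ℕ → ℕ
  size j = length (level j)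

below-mono : ∀ {h h'} → h ≤ h' → below h ≤ below h'
below-mono {h' = zero} z≤n = ≤-refl
below-mono {h} {suc h'} h≤ with m≤n⇒m<n∨m≡n h≤
... | inj₂ refl = ≤-refl
... | inj₁ (s≤s h≤h') = ≤-trans (below-mono h≤h')
  (subst (below h' ≤_) (sym (below-suc h')) (m≤m+n (below h') _))

-- Every level is nonempty, so at least H vertices lie below level H.
below-ge : ∀ H → H ≤ below H
below-ge zero    = z≤n
below-ge (suc H) = subst (suc H ≤_) (sym (below-suc H))
  (subst (_≤ below H + length (level H)) (+-comm H 1) (+-mono-≤ (below-ge H) (level-nonempty H)))

position-before : ∀ {h h' j} j' → j < length (level h) → h < h' → below h + j < below h' + j'
position-before {h} {j = j} j' j< h<h' = <-≤-trans
  (subst (below h + j <_) (sym (below-suc h)) (+-monoʳ-< (below h) j<))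
  (≤-trans (below-mono h<h') (m≤m+n _ j'))

height-unique : ∀ {h h' j j'} → j < length (level h) → j' < length (level h') →
  below h + j ≡ below h' + j' → h ≡ h'
height-unique {h} {h'} {j} {j'} j< j'< eq with <-cmp h h'
... | tri< h<h' _ _ = ⊥-elim (<-irrefl eq (position-before j' j< h<h'))
... | tri≈ _ h≡h' _ = h≡h'
... | tri> _ _ h'<h = ⊥-elim (<-irrefl (sym eq) (position-before j j'< h'<h))

locate : ∀ H n → n < below H →
  Σ ℕ λ h → Σ ℕ λ j → j < length (level h) × n ≡ below h + j
locate zero    n ()
locate (suc H) n n< with n <? below H
... | yes n<' = locate H n n<'
... | no n≮ with m≤n⇒∃[o]m+o≡n (≮⇒≥ n≮)
... | j , refl = H , j , +-cancelˡ-< (below H) _ _ (subst (below H + j <_) (below-suc H) n<) , refl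

-- (4) Labels

-- The vertex (p , t) carries label n; Labelled p n is Σ over t of this.
LabelledAs : Path → Ty → ℕ → Set
LabelledAs p t n = Σ (List Vertex) λ xs → Σ (List Vertex) λ ys →
  (level (length p) ≡ xs ++ (p , t) ∷ ys) × (n ≡ below (length p) + length ys + 1)

labelled-isVertex : ∀ {p t n} → LabelledAs p t n → IsVertex p t
labelled-isVertex (xs , _ , e , _) = subst (_ ∈_) (sym e) (∈-++⁺ʳ xs (here refl))

label-injective : ∀ {p t p' t' n} → LabelledAs p t n → LabelledAs p' t' n → (p , t) ≡ (p' , t')
label-injective {p} {t} {p'} {t'} (xs , ys , e , refl) (xs' , ys' , e' , n≡) =
  ∷-injectiveˡ (proj₂ (++-split-suffix xs xs' same-level (cong suc same-offset)))
  where
  same-position : below (length p) + length ys ≡ below (length p') + length ys'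
  same-position = +-cancelʳ-≡ 1 _ _ n≡
  same-height : length p ≡ length p'
  same-height = height-unique (suffix-shorter xs e) (suffix-shorter xs' e') same-position
  same-level : xs ++ (p , t) ∷ ys ≡ xs' ++ (p' , t') ∷ ys'
  same-level = trans (sym e) (trans (cong level same-height) e')
  same-offset : length ys ≡ length ys'
  same-offset = +-cancelˡ-≡ (below (length p)) _ _
    (trans same-position (cong (λ h → below h + length ys') (sym same-height)))

label-at : ∀ {p t t' n} xs' ys' → LabelledAs p t n → level (length p) ≡ xs' ++ (p , t') ∷ ys' →
  t ≡ t' × n ≡ below (length p) + length ys' + 1
label-at {p} xs' ys' (xs , ys , e , refl) e'
  with distinct-position xs xs' (subst Distinct e (level-distinct (length p))) (trans (sym e) e')
... | refl , refl = refl , refl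

label-unique : ∀ {p t t' n n'} → LabelledAs p t n → LabelledAs p t' n' → n ≡ n'
label-unique l (xs' , ys' , e' , refl) = proj₂ (label-at xs' ys' l e')

vertex-type : ∀ {p t t' n} → LabelledAs p t n → IsVertex p t' → t ≡ t'
vertex-type l v with ∈-∃++ v
... | xs' , ys' , e' = proj₁ (label-at xs' ys' l e')

isVertex-labelled : ∀ {p t} → IsVertex p t → Σ ℕ λ m → below (length p) ≤ m × LabelledAs p t (suc m)
isVertex-labelled {p} v with ∈-∃++ v
... | xs , ys , e = below (length p) + length ys , m≤m+n _ _ , xs , ys , e , +-comm 1 _

label-exists : ∀ n → Σ Path λ p → Σ Ty λ t → LabelledAs p t (suc n)
label-exists n with locate (suc n) n (below-ge (suc n))
... | h , j , j< , refl with split-from-right (level h) j j<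
... | xs , (p , t) , ys , e , refl with split-level-path h xs ys e
... | refl = p , t , xs , ys , e , +-comm 1 _

-- (5) Frequencies

freq-unique : ∀ {n c c'} → IsFreq n c → IsFreq n c' → c ≡ c'
freq-unique (xs , xs! , refl , ∈xs) (ys , ys! , refl , ∈ys) =
  ↭-length (∼bag⇒↭ (unique∧set⇒bag xs! ys! λ {m} → ⇔.trans (∈xs m) (⇔.sym (∈ys m))))

child-label : ∀ {p t q t'} → IsVertex p t → (q , t') ∈ children (p , t) →
  Σ ℕ λ m → 1 ≤ m × LabelledAs q t' (suc m)
child-label {p} {t} v c with ∈-children (p , t) c
... | i , refl , _ with isVertex-labelled (child-isVertex v c)
... | m , below≤m , l = m , ≤-trans below-pos below≤m , l
  where
  below-pos : 1 ≤ below (length (p ∷ʳ i))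
  below-pos = subst (λ h → 1 ≤ below h) (sym (length-snoc p i))
    (≤-trans (s≤s z≤n) (below-ge (suc (length p))))

child-IsG : ∀ {p t n i t' m} → LabelledAs p t n → 1 ≤ m → LabelledAs (p ∷ʳ i) t' (suc m) →
  1 ≤ m × IsG m n
child-IsG {p} {t} {i = i} {t'} l m≥1 lc = m≥1 , p , i , (t' , lc) , (t , l)

IsG-child : ∀ {p t n m q i t' t''} → LabelledAs p t n →
  LabelledAs (q ∷ʳ i) t' (suc m) → LabelledAs q t'' n → ChildIndex t i × LabelledAs (p ∷ʳ i) t' (suc m)
IsG-child {i = i} l lc lq with label-injective lq l
... | refl with parent-isVertex (labelled-isVertex lc)
... | _ , v , ok = subst (λ s → ChildIndex s i) (sym (vertex-type l v)) ok , lc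

freq-of-vertex : ∀ {p t n} → LabelledAs p t n → IsFreq n (arity t)
freq-of-vertex {p} {A} {n} l =
  (m₀ ∷ m₁ ∷ []) , ((m₀≢m₁ ∷ []) ∷ [] ∷ []) , refl , λ m → mk⇔ (to m) (from m)
  where
  c₀ : Σ ℕ λ m → 1 ≤ m × LabelledAs (p ∷ʳ 0) A (suc m)
  c₀ = child-label (labelled-isVertex l) (here refl)
  c₁ : Σ ℕ λ m → 1 ≤ m × LabelledAs (p ∷ʳ 1) B (suc m)
  c₁ = child-label (labelled-isVertex l) (there (here refl))
  m₀ m₁ : ℕ
  m₀ = proj₁ c₀
  m₁ = proj₁ c₁
  m₀≢m₁ : m₀ ≢ m₁
  m₀≢m₁ eq = siblings-differ p (cong proj₁ (label-injective (proj₂ (proj₂ c₀))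
    (subst (λ m → LabelledAs (p ∷ʳ 1) B (suc m)) (sym eq) (proj₂ (proj₂ c₁)))))
  to : ∀ m → m ∈ m₀ ∷ m₁ ∷ [] → 1 ≤ m × IsG m n
  to _ (here refl)         = child-IsG l (proj₁ (proj₂ c₀)) (proj₂ (proj₂ c₀))
  to _ (there (here refl)) = child-IsG l (proj₁ (proj₂ c₁)) (proj₂ (proj₂ c₁))
  from : ∀ m → 1 ≤ m × IsG m n → m ∈ m₀ ∷ m₁ ∷ []
  from m (_ , _ , _ , (_ , lc) , (_ , lq)) with IsG-child l lc lq
  ... | inj₁ refl , lc' = here (suc-injective (label-unique lc' (proj₂ (proj₂ c₀))))
  ... | inj₂ refl , lc' = there (here (suc-injective (label-unique lc' (proj₂ (proj₂ c₁)))))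
freq-of-vertex {p} {B} {n} l = (m₀ ∷ []) , ([] ∷ []) , refl , λ m → mk⇔ (to m) (from m)
  where
  c₀ : Σ ℕ λ m → 1 ≤ m × LabelledAs (p ∷ʳ 0) A (suc m)
  c₀ = child-label (labelled-isVertex l) (here refl)
  m₀ : ℕ
  m₀ = proj₁ c₀
  to : ∀ m → m ∈ m₀ ∷ [] → 1 ≤ m × IsG m n
  to _ (here refl) = child-IsG l (proj₁ (proj₂ c₀)) (proj₂ (proj₂ c₀))
  from : ∀ m → 1 ≤ m × IsG m n → m ∈ m₀ ∷ []
  from m (_ , _ , _ , (_ , lc) , (_ , lq)) with IsG-child l lc lq
  ... | refl , lc' = here (suc-injective (label-unique lc' (proj₂ (proj₂ c₀))))

frequency : ℕ → ℕ
frequency zero    = 0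
frequency (suc n) = arity (proj₁ (proj₂ (label-exists n)))

frequency-isFreq : (n : ℕ) → 1 ≤ n → IsFreq n (frequency n)
frequency-isFreq (suc n) _ = freq-of-vertex (proj₂ (proj₂ (label-exists n)))

-- (6) The level words and the factorization

rowWord : List Vertex → List ℕ
rowWord vs = reverse (map (arity ∘ proj₂) vs)

levelWord : ℕ → List ℕ
levelWord h = rowWord (level h)

levelsWord : ℕ → List ℕ
levelsWord zero    = []
levelsWord (suc H) = levelsWord H ++ levelWord H

-- What a letter (an arity) of one level word becomes on the next level.
expand : ℕ → List ℕ
expand 1 = 2 ∷ []
expand _ = 1 ∷ 2 ∷ []

rowWord-children : ∀ vs → rowWord (concatMap children vs) ≡ concatMap expand (rowWord vs)
rowWord-children [] = refl
rowWord-children (v ∷ vs) = begin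
    reverse (map a (children v ++ concatMap children vs))
  ≡⟨ cong reverse (map-++ a (children v) (concatMap children vs)) ⟩
    reverse (map a (children v) ++ map a (concatMap children vs))
  ≡⟨ reverse-++ (map a (children v)) _ ⟩
    rowWord (concatMap children vs) ++ rowWord (children v)
  ≡⟨ cong₂ _++_ (rowWord-children vs) (one-vertex v) ⟩
    concatMap expand (rowWord vs) ++ concatMap expand (a v ∷ [])
  ≡⟨ sym (concatMap-++ expand (rowWord vs) (a v ∷ [])) ⟩
    concatMap expand (rowWord vs ∷ʳ a v)
  ≡⟨ cong (concatMap expand) (sym (unfold-reverse (a v) (map a vs))) ⟩
    concatMap expand (rowWord (v ∷ vs)) ∎
  where
  open ≡-Reasoning
  a : Vertex → ℕ
  a = arity ∘ proj₂
  one-vertex : ∀ v → rowWord (children v) ≡ concatMap expand (a v ∷ [])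
  one-vertex (_ , A) = refl
  one-vertex (_ , B) = refl

levelWord-fib : ∀ h → levelWord (2 + h) ≡ levelWord h ++ levelWord (1 + h)
levelWord-fib zero    = refl
levelWord-fib (suc h) = begin
    levelWord (3 + h)                                        ≡⟨ step (2 + h) ⟩
    concatMap expand (levelWord (2 + h))                     ≡⟨ cong (concatMap expand) (levelWord-fib h) ⟩
    concatMap expand (levelWord h ++ levelWord (1 + h))      ≡⟨ concatMap-++ expand (levelWord h) _ ⟩
    concatMap expand (levelWord h) ++ concatMap expand (levelWord (1 + h))
                                                             ≡⟨ cong₂ _++_ (sym (step h)) (sym (step (1 + h))) ⟩
    levelWord (1 + h) ++ levelWord (2 + h)                   ∎
  where
  open ≡-Reasoning
  step : ∀ h → levelWord (suc h) ≡ concatMap expand (levelWord h)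
  step h = rowWord-children (level h)

levelWord-w : ∀ h → levelWord h ≡ w (3 + h)
levelWord-w zero          = refl
levelWord-w (suc zero)    = refl
levelWord-w (suc (suc h)) = trans (levelWord-fib h) (cong₂ _++_ (levelWord-w h) (levelWord-w (suc h)))

factorPrefix-suc : ∀ k → factorPrefix (suc k) ≡ factorPrefix k ++ (w (3 + k) ++ w (3 + k))
factorPrefix-suc k = cong (λ z → 2 ∷ 1 ∷ z) (begin
    concat (map square (upTo (suc k)))          ≡⟨ cong (concat ∘ map square) (sym (upTo-∷ʳ k)) ⟩
    concat (map square (upTo k ∷ʳ k))           ≡⟨ cong concat (map-++ square (upTo k) (k ∷ [])) ⟩
    concat (map square (upTo k) ++ square k ∷ []) ≡⟨ sym (concat-++ (map square (upTo k)) (square k ∷ [])) ⟩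
    concat (map square (upTo k)) ++ (square k ++ []) ≡⟨ cong (concat (map square (upTo k)) ++_) (++-identityʳ (square k)) ⟩
    concat (map square (upTo k)) ++ square k    ∎)
  where
  open ≡-Reasoning
  square : ℕ → List ℕ
  square j = w (3 + j) ++ w (3 + j)

factorPrefix-levels : ∀ k → factorPrefix k ++ w (3 + k) ≡ levelsWord (2 + k)
factorPrefix-levels zero    = refl
factorPrefix-levels (suc k) = begin
    factorPrefix (suc k) ++ w (4 + k)
  ≡⟨ cong (_++ w (4 + k)) (factorPrefix-suc k) ⟩
    (factorPrefix k ++ (w (3 + k) ++ w (3 + k))) ++ w (4 + k)
  ≡⟨ ++-assoc (factorPrefix k) _ _ ⟩
    factorPrefix k ++ ((w (3 + k) ++ w (3 + k)) ++ w (4 + k))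
  ≡⟨ cong (factorPrefix k ++_) (++-assoc (w (3 + k)) _ _) ⟩
    factorPrefix k ++ (w (3 + k) ++ w (5 + k))
  ≡⟨ sym (++-assoc (factorPrefix k) _ _) ⟩
    (factorPrefix k ++ w (3 + k)) ++ w (5 + k)
  ≡⟨ cong₂ _++_ (factorPrefix-levels k) (sym (levelWord-w (2 + k))) ⟩
    levelsWord (3 + k) ∎
  where open ≡-Reasoning

prefixW-suc : ∀ f L → prefixW f (suc L) ≡ prefixW f L ∷ʳ f (suc L)
prefixW-suc f L = trans (cong (map (f ∘ suc)) (sym (upTo-∷ʳ L))) (map-++ _ (upTo L) (L ∷ []))

length-prefixW : ∀ f L → length (prefixW f L) ≡ L
length-prefixW f L = trans (length-map _ (upTo L)) (length-upTo L)

prefixW-extends : ∀ f a b → Σ (List ℕ) λ r → prefixW f (a + b) ≡ prefixW f a ++ r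
prefixW-extends f a zero = [] , trans (cong (prefixW f) (+-identityʳ a)) (sym (++-identityʳ _))
prefixW-extends f a (suc b) with prefixW-extends f a b
... | r , e = r ∷ʳ f (suc (a + b)) ,
  trans (cong (prefixW f) (+-suc a b)) (trans (prefixW-suc f (a + b))
    (trans (cong (_∷ʳ f (suc (a + b))) e) (++-assoc (prefixW f a) r _)))

module FrequencyWord (f : ℕ → ℕ) (f-freq : (n : ℕ) → 1 ≤ n → IsFreq n (f n)) where
  open ≡-Reasoning

  f-at-vertex : ∀ {p t n} → LabelledAs p t n → f n ≡ arity t
  f-at-vertex l@(_ , _ , _ , refl) = freq-unique (f-freq _ (m≤n+m 1 _)) (freq-of-vertex l)

  f-in-level : ∀ h xs {p t} ys → level h ≡ xs ++ (p , t) ∷ ys →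
    f (suc (below h + length ys)) ≡ arity t
  f-in-level h xs {t = t} ys e with split-level-path h xs ys e
  ... | refl = subst (λ n → f n ≡ arity t) (+-comm _ 1) (f-at-vertex (xs , ys , e , refl))

  prefixW-suffix : ∀ h xs ys → level h ≡ xs ++ ys →
    prefixW f (below h + length ys) ≡ prefixW f (below h) ++ rowWord ys
  prefixW-suffix h xs [] e = trans (cong (prefixW f) (+-identityʳ _)) (sym (++-identityʳ _))
  prefixW-suffix h xs ((p , t) ∷ ys) e = begin
      prefixW f (below h + suc (length ys))
    ≡⟨ cong (prefixW f) (+-suc (below h) (length ys)) ⟩
      prefixW f (suc (below h + length ys))
    ≡⟨ prefixW-suc f _ ⟩
      prefixW f (below h + length ys) ∷ʳ f (suc (below h + length ys))
    ≡⟨ cong₂ _∷ʳ_ (prefixW-suffix h (xs ∷ʳ (p , t)) ys (trans e (sym (++-assoc xs _ ys))))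
                  (f-in-level h xs ys e) ⟩
      (prefixW f (below h) ++ rowWord ys) ∷ʳ arity t
    ≡⟨ ++-assoc (prefixW f (below h)) (rowWord ys) (arity t ∷ []) ⟩
      prefixW f (below h) ++ (rowWord ys ∷ʳ arity t)
    ≡⟨ cong (prefixW f (below h) ++_) (sym (unfold-reverse (arity t) (map (arity ∘ proj₂) ys))) ⟩
      prefixW f (below h) ++ rowWord ((p , t) ∷ ys) ∎

  prefixW-levels : ∀ H → prefixW f (below H) ≡ levelsWord H
  prefixW-levels zero    = refl
  prefixW-levels (suc H) = trans (cong (prefixW f) (below-suc H))
    (trans (prefixW-suffix H [] (level H) refl) (cong (_++ levelWord H) (prefixW-levels H)))

W-factorization : (f : ℕ → ℕ) → ((n : ℕ) → 1 ≤ n → IsFreq n (f n))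
  → (k : ℕ) → prefixW f (length (factorPrefix k)) ≡ factorPrefix k
W-factorization f f-freq k with prefixW-extends f (length (factorPrefix k)) (length (w (3 + k)))
... | r , extends = proj₁ (++-split-prefix _ (factorPrefix k) (trans (sym extends) both)
                                            (length-prefixW f _))
  where
  open FrequencyWord f f-freq
  both-lengths : length (factorPrefix k) + length (w (3 + k)) ≡ below (2 + k)
  both-lengths = trans (sym (length-++ (factorPrefix k))) (trans (cong length (factorPrefix-levels k))
    (trans (cong length (sym (prefixW-levels (2 + k)))) (length-prefixW f _)))
  both : prefixW f (length (factorPrefix k) + length (w (3 + k))) ≡ factorPrefix k ++ w (3 + k)
  both = trans (cong (prefixW f) both-lengths)
    (trans (prefixW-levels (2 + k)) (sym (factorPrefix-levels k)))

corollary2p4 : (Σ (ℕ → ℕ) λ f → (n : ℕ) → 1 ≤ n → IsFreq n (f n))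
    × ((f : ℕ → ℕ) → ((n : ℕ) → 1 ≤ n → IsFreq n (f n))
       → (k : ℕ) → prefixW f (length (factorPrefix k)) ≡ factorPrefix k)
corollary2p4 = (frequency , frequency-isFreq) , W-factorization
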